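{- Consider the game $K^1$. A position $(a,b)\in\mathbb{N}^2$ with $a\le b$ is a $\mathcal{P}$-position of $K^1$ if and only if either $(a,b)\in\{(0,0),(0,1)\}$, or $a\ge 1$, $\mathrm{rep}_F(a)$ ends with the digit $0$ and $\mathrm{rep}_F(b)=\mathrm{rep}_F(a)1$ (the word $\mathrm{rep}_F(a)$ followed by the digit $1$).
   Context: Positions are pairs $(x,y)\in\mathbb{N}^2$. A Wythoff move from $(x,y)$ leads to $(x-i,y)$ with $1\le i\le x$, to $(x,y-i)$ with $1\le i\le y$, or to $(x-i,y-i)$ with $1\le i\le\min(x,y)$. For $\ell\in\mathbb{N}$, $K^\ell$ is the two-player impartial game with Wythoff moves in which the positions of $\{(x,y): x+y\le\ell\}$ are terminal: no move is allowed from a terminal position, and a player who moves into a terminal position wins (normal play: a player unable to move loses). A $\mathcal{P}$-position is a position from which the previous player (the one not about to move) has a winning strategy; in particular every terminal position is a $\mathcal{P}$-position. The Fibonacci sequence is $F_0=1$, $F_1=2$, $F_{n+2}=F_{n+1}+F_n$; for $n>0$, $\mathrm{rep}_F(n)$ is the greedy representation $d_k\cdots d_0$ over $\{0,1\}$ with $n=\sum d_iF_i$, $d_k\neq0$, no two consecutive $1$'s; $\mathrm{rep}_F(0)$ is the empty word. -}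

module Defs where

open import Data.Nat using (ℕ; zero; suc; _+_; _∸_; _≤_; _<_; _≤ᵇ_)
open import Data.Bool using (if_then_else_)
open import Data.List using (List; []; _∷_)

data Move : ℕ → ℕ → ℕ → ℕ → Set where
  left  : ∀ {x y} i → 1 ≤ i → i ≤ x → Move x y (x ∸ i) y
  right : ∀ {x y} i → 1 ≤ i → i ≤ y → Move x y x (y ∸ i)
  diag  : ∀ {x y} i → 1 ≤ i → i ≤ x → i ≤ y → Move x y (x ∸ i) (y ∸ i)

-- P- and N-positions of the game K^ℓ (positions with x + y ≤ ℓ are terminal,
-- no moves from them).
data IsP (ℓ : ℕ) (x y : ℕ) : Set
data IsN (ℓ : ℕ) (x y : ℕ) : Set

data IsP ℓ x y where
  terminal : x + y ≤ ℓ → IsP ℓ x y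
  allN     : ℓ < x + y →
             (∀ x' y' → Move x y x' y' → IsN ℓ x' y') → IsP ℓ x y

data IsN ℓ x y where
  someP : ℓ < x + y → ∀ x' y' → Move x y x' y' → IsP ℓ x' y' → IsN ℓ x y

F : ℕ → ℕ
F zero = 1
F (suc zero) = 2
F (suc (suc n)) = F (suc n) + F n

-- number of indices i < n with F i ≤ n  (= k+1 where F k ≤ n < F (k+1),
-- and 0 for n = 0; note F i > i so indices i ≥ n never qualify)
countLe : ℕ → ℕ → ℕ
countLe zero n = 0
countLe (suc i) n = if F i ≤ᵇ n then suc (countLe i n) else countLe i n

greedy : ℕ → ℕ → List ℕ
greedy zero r = []
greedy (suc i) r = if F i ≤ᵇ r then 1 ∷ greedy i (r ∸ F i) else 0 ∷ greedy i r

-- rep_F n : greedy Fibonacci representation d_k ⋯ d_0, most significant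
-- digit first; rep_F 0 is the empty word.
repF : ℕ → List ℕ
repF n = greedy (countLe n n) n

{-# OPTIONS --safe #-}
module Submission where

-- Let shift m = value 1 (repF m), the number whose Zeckendorf word is repF m ∷ʳ 0.  As
-- F (k + 2) = F (k + 1) + F k, the word repF m ∷ʳ 0 ∷ʳ 1 belongs to shift m + m + 1, so the
-- pairs of the statement are (shift m , shift m + m + 1) for m ≥ 1.  The word of n ≥ 2 ends
-- in 0 or in 01, so n is a first or a second coordinate of such a pair, and never both; the
-- difference m + 1 determines the pair; and shift is increasing, because Zeckendorf words of
-- equal length are ordered lexicographically whatever the offset of the weights.  As for
-- Wythoff's game, these pairs, their mirror images and the terminal positions then form a
-- kernel of the move graph: no move joins two of its non-terminal positions, and every other
-- position moves into it (below a pair, diagonally to the pair with the same difference or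
-- to a terminal position).  In an acyclic game the kernel is the set of P-positions.

open import Defs
open import Data.Bool using (true; false)
open import Data.List using (List; []; _∷_; _++_; [_]; _∷ʳ_; length; replicate)
open import Data.List.Properties using (length-++; length-replicate; ++-assoc; ∷ʳ-injectiveˡ; ∷ʳ-injectiveʳ)
open import Data.Nat
open import Data.Nat.Properties
open import Algebra.Properties.CommutativeSemigroup +-commutativeSemigroup using (interchange)
open import Data.Product using (_×_; _,_; proj₁; proj₂; ∃-syntax; ∃₂)
open import Data.Sum using (_⊎_; inj₁; inj₂)
import Data.Sum as Sum
open import Function using (_∘_)
open import Function.Bundles using (_⇔_; mk⇔)
open import Function.Properties.Equivalence using () renaming (trans to ⇔-trans)
open import Relation.Binary.Definitions using (tri<; tri≈; tri>)
open import Relation.Binary.PropositionalEquality hiding ([_])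
open import Relation.Nullary using (¬_; yes; no; contradiction)
open import Relation.Nullary.Decidable using (dec-true; dec-false)

0<F : ∀ n → 0 < F n
0<F zero = s≤s z≤n
0<F (suc zero) = s≤s z≤n
0<F (suc (suc n)) = <-≤-trans (0<F (suc n)) (m≤m+n _ _)

F[n]<F[1+n] : ∀ n → F n < F (suc n)
F[n]<F[1+n] zero = s≤s (s≤s z≤n)
F[n]<F[1+n] (suc n) = m<m+n (F (suc n)) (0<F n)

F-mono-≤ : ∀ {i j} → i ≤ j → F i ≤ F j
F-mono-≤ = go ∘ ≤⇒≤′
  where
  go : ∀ {i j} → i ≤′ j → F i ≤ F j
  go ≤′-refl = ≤-refl
  go {j = suc j} (≤′-step i≤′j) = ≤-trans (go i≤′j) (<⇒≤ (F[n]<F[1+n] j))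

n<F[n] : ∀ n → n < F n
n<F[n] zero = s≤s z≤n
n<F[n] (suc n) = <-≤-trans (s≤s (n<F[n] n)) (F[n]<F[1+n] n)

-- Zeckendorf words

value : ℕ → List ℕ → ℕ
value k [] = 0
value k (d ∷ w) = d * F (k + length w) + value k w

value-1∷ : ∀ k w → value k (1 ∷ w) ≡ F (k + length w) + value k w
value-1∷ k w = cong (_+ value k w) (*-identityˡ _)

F≤value-1∷ : ∀ k w → F (k + length w) ≤ value k (1 ∷ w)
F≤value-1∷ k w = ≤-trans (m≤m+n _ _) (≤-reflexive (sym (value-1∷ k w)))

value-∷ʳ : ∀ k w d → value k (w ∷ʳ d) ≡ value (suc k) w + d * F k
value-∷ʳ k [] d = trans (+-identityʳ _) (cong (λ i → d * F i) (+-identityʳ k))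
value-∷ʳ k (x ∷ w) d = begin
  x * F (k + length (w ∷ʳ d)) + value k (w ∷ʳ d)
    ≡⟨ cong₂ (λ l r → x * F l + r) length-eq (value-∷ʳ k w d) ⟩
  x * F (suc k + length w) + (value (suc k) w + d * F k)
    ≡⟨ sym (+-assoc (x * F (suc k + length w)) _ _) ⟩
  x * F (suc k + length w) + value (suc k) w + d * F k
    ∎
  where
  open ≡-Reasoning
  length-eq : k + length (w ∷ʳ d) ≡ suc k + length w
  length-eq = trans (cong (k +_) (trans (length-++ w) (+-comm _ 1))) (+-suc k _)

value-fib : ∀ k w → value (2 + k) w ≡ value (1 + k) w + value k w
value-fib k [] = refl
value-fib k (x ∷ w) = begin
  x * (F (suc i) + F i) + value (2 + k) w
    ≡⟨ cong₂ _+_ (*-distribˡ-+ x _ _) (value-fib k w) ⟩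
  (x * F (suc i) + x * F i) + (value (1 + k) w + value k w)
    ≡⟨ interchange (x * F (suc i)) (x * F i) (value (1 + k) w) (value k w) ⟩
  (x * F (suc i) + value (1 + k) w) + (x * F i + value k w)
    ∎
  where
  open ≡-Reasoning
  i = k + length w

data Zeckendorf : List ℕ → Set where
  []   : Zeckendorf []
  0∷_  : ∀ {w} → Zeckendorf w → Zeckendorf (0 ∷ w)
  1∷[] : Zeckendorf (1 ∷ [])
  10∷_ : ∀ {w} → Zeckendorf w → Zeckendorf (1 ∷ 0 ∷ w)

data Normal : List ℕ → Set where
  []  : Normal []
  1∷_ : ∀ {w} → Zeckendorf (1 ∷ w) → Normal (1 ∷ w)

Normal⇒Zeckendorf : ∀ {w} → Normal w → Zeckendorf w
Normal⇒Zeckendorf [] = []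
Normal⇒Zeckendorf (1∷ z) = z

Zeckendorf-tail : ∀ {d w} → Zeckendorf (d ∷ w) → Zeckendorf w
Zeckendorf-tail (0∷ z) = z
Zeckendorf-tail 1∷[] = []
Zeckendorf-tail (10∷ z) = 0∷ z

Zeckendorf-++ : ∀ {u v} → Zeckendorf u → Zeckendorf (0 ∷ v) → Zeckendorf (u ++ 0 ∷ v)
Zeckendorf-++ [] z′ = z′
Zeckendorf-++ (0∷ z) z′ = 0∷ Zeckendorf-++ z z′
Zeckendorf-++ 1∷[] z′ = 10∷ Zeckendorf-tail z′
Zeckendorf-++ (10∷ z) z′ = 10∷ Zeckendorf-++ z z′

Zeckendorf-++⁻ˡ : ∀ u {v} → Zeckendorf (u ++ v) → Zeckendorf u
Zeckendorf-++⁻ˡ [] _ = []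
Zeckendorf-++⁻ˡ (0 ∷ u) (0∷ z) = 0∷ Zeckendorf-++⁻ˡ u z
Zeckendorf-++⁻ˡ (1 ∷ []) _ = 1∷[]
Zeckendorf-++⁻ˡ (1 ∷ 0 ∷ u) (10∷ z) = 10∷ Zeckendorf-++⁻ˡ u z

Normal-++ : ∀ {u v} → Normal u → 0 < value 0 u → Zeckendorf (0 ∷ v) → Normal (u ++ 0 ∷ v)
Normal-++ (1∷ z) _ z′ = 1∷ Zeckendorf-++ z z′

Normal-++⁻ˡ : ∀ u {v} → Normal (u ++ v) → Normal u
Normal-++⁻ˡ [] _ = []
Normal-++⁻ˡ (1 ∷ u) (1∷ z) = 1∷ Zeckendorf-++⁻ˡ (1 ∷ u) z

value-< : ∀ k {w} → Zeckendorf w → value k w < F (k + length w)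
value-< k [] = 0<F (k + 0)
value-< k {0 ∷ w} (0∷ z) = begin-strict
  value k w                <⟨ value-< k z ⟩
  F (k + length w)         <⟨ F[n]<F[1+n] (k + length w) ⟩
  F (suc (k + length w))   ≡⟨ cong F (sym (+-suc k (length w))) ⟩
  F (k + suc (length w))   ∎
  where open ≤-Reasoning
value-< k 1∷[] = begin-strict
  value k (1 ∷ [])         ≡⟨ trans (value-1∷ k []) (+-identityʳ _) ⟩
  F (k + 0)                <⟨ F[n]<F[1+n] (k + 0) ⟩
  F (suc (k + 0))          ≡⟨ cong F (sym (+-suc k 0)) ⟩
  F (k + 1)                ∎
  where open ≤-Reasoning
value-< k {1 ∷ 0 ∷ w} (10∷ z) = begin-strict
  value k (1 ∷ 0 ∷ w)                        ≡⟨ value-1∷ k (0 ∷ w) ⟩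
  F (k + suc l) + value k w                  <⟨ +-monoʳ-< _ (value-< k z) ⟩
  F (k + suc l) + F (k + l)                  ≡⟨ cong (λ i → F i + F (k + l)) (+-suc k l) ⟩
  F (suc (suc (k + l)))                      ≡⟨ cong F (sym (trans (+-suc k (suc l)) (cong suc (+-suc k l)))) ⟩
  F (k + suc (suc l))                        ∎
  where
  open ≤-Reasoning
  l = length w

≤ᵇ-true : ∀ {m n} → m ≤ n → (m ≤ᵇ n) ≡ true
≤ᵇ-true {m} {n} = dec-true (m ≤? n)

≤ᵇ-false : ∀ {m n} → n < m → (m ≤ᵇ n) ≡ false
≤ᵇ-false {m} {n} n<m = dec-false (m ≤? n) (<⇒≱ n<m)

greedy-1 : ∀ i {r} → F i ≤ r → greedy (suc i) r ≡ 1 ∷ greedy i (r ∸ F i)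
greedy-1 _ F≤r rewrite ≤ᵇ-true F≤r = refl

greedy-0 : ∀ i {r} → r < F i → greedy (suc i) r ≡ 0 ∷ greedy i r
greedy-0 _ r<F rewrite ≤ᵇ-false r<F = refl

countLe-1 : ∀ i {n} → F i ≤ n → countLe (suc i) n ≡ suc (countLe i n)
countLe-1 _ F≤n rewrite ≤ᵇ-true F≤n = refl

countLe-0 : ∀ i {n} → n < F i → countLe (suc i) n ≡ countLe i n
countLe-0 _ n<F rewrite ≤ᵇ-false n<F = refl

length-greedy : ∀ i r → length (greedy i r) ≡ i
length-greedy zero r = refl
length-greedy (suc i) r with F i ≤ᵇ r
... | true = cong suc (length-greedy i (r ∸ F i))
... | false = cong suc (length-greedy i r)

remainder<F : ∀ i {r} → r < F (suc (suc i)) → F (suc i) ≤ r → r ∸ F (suc i) < F i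
remainder<F i r<F F≤r = +-cancelˡ-< (F (suc i)) _ _ (subst (_< F (suc i) + F i) (sym (m+[n∸m]≡n F≤r)) r<F)

greedy-10∷ : ∀ i {r} → r < F (suc (suc i)) → F (suc i) ≤ r →
             greedy (suc (suc i)) r ≡ 1 ∷ 0 ∷ greedy i (r ∸ F (suc i))
greedy-10∷ i r<F F≤r = trans (greedy-1 (suc i) F≤r) (cong (1 ∷_) (greedy-0 i (remainder<F i r<F F≤r)))

greedy-correct : ∀ i {r} → r < F i → Zeckendorf (greedy i r) × value 0 (greedy i r) ≡ r
greedy-correct zero {zero} _ = [] , refl
greedy-correct zero {suc _} (s≤s ())
greedy-correct (suc i) {r} r<F with F i ≤? r
... | no F≰r with z , eq ← greedy-correct i (≰⇒> F≰r) =
  subst (λ w → Zeckendorf w × value 0 w ≡ r) (sym (greedy-0 i (≰⇒> F≰r))) (0∷ z , eq)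
greedy-correct (suc zero) {zero} _ | yes ()
greedy-correct (suc zero) {suc zero} _ | yes _ = 1∷[] , refl
greedy-correct (suc zero) {suc (suc _)} (s≤s (s≤s ())) | yes _
greedy-correct (suc (suc i)) {r} r<F | yes F≤r with z , eq ← greedy-correct i (remainder<F i r<F F≤r) =
  subst (λ w → Zeckendorf w × value 0 w ≡ r) (sym (greedy-10∷ i r<F F≤r)) (10∷ z , value≡)
  where
  g = greedy i (r ∸ F (suc i))
  value≡ : value 0 (1 ∷ 0 ∷ g) ≡ r
  value≡ = begin
    value 0 (1 ∷ 0 ∷ g)                 ≡⟨ value-1∷ 0 (0 ∷ g) ⟩
    F (suc (length g)) + value 0 g      ≡⟨ cong₂ (λ l v → F (suc l) + v) (length-greedy i _) eq ⟩
    F (suc i) + (r ∸ F (suc i))         ≡⟨ m+[n∸m]≡n F≤r ⟩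
    r                                   ∎
    where open ≡-Reasoning

greedy-value : ∀ {w} → Zeckendorf w → greedy (length w) (value 0 w) ≡ w
greedy-value [] = refl
greedy-value {0 ∷ w} (0∷ z) = trans (greedy-0 (length w) (value-< 0 z)) (cong (0 ∷_) (greedy-value z))
greedy-value 1∷[] = refl
greedy-value {1 ∷ 0 ∷ w} (10∷ z) = begin
  greedy (2 + l) (value 0 (1 ∷ 0 ∷ w))
    ≡⟨ greedy-1 (1 + l) (F≤value-1∷ 0 (0 ∷ w)) ⟩
  1 ∷ greedy (1 + l) (value 0 (1 ∷ 0 ∷ w) ∸ F (1 + l))
    ≡⟨ cong (λ r → 1 ∷ greedy (1 + l) r) leading-removed ⟩
  1 ∷ greedy (1 + l) (value 0 w)
    ≡⟨ cong (1 ∷_) (greedy-0 l (value-< 0 z)) ⟩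
  1 ∷ 0 ∷ greedy l (value 0 w)
    ≡⟨ cong (λ u → 1 ∷ 0 ∷ u) (greedy-value z) ⟩
  1 ∷ 0 ∷ w
    ∎
  where
  open ≡-Reasoning
  l = length w
  leading-removed : value 0 (1 ∷ 0 ∷ w) ∸ F (1 + l) ≡ value 0 w
  leading-removed = trans (cong (_∸ F (1 + l)) (value-1∷ 0 (0 ∷ w))) (m+n∸m≡n (F (1 + l)) (value 0 w))

countLe-between : ∀ {l n} → F l ≤ n → n < F (suc l) → ∀ i → countLe i n ≡ i ⊓ suc l
countLe-between lo hi zero = refl
countLe-between {l} {n} lo hi (suc i) with i ≤? l
... | yes i≤l = begin
  countLe (suc i) n        ≡⟨ countLe-1 i (≤-trans (F-mono-≤ i≤l) lo) ⟩
  suc (countLe i n)        ≡⟨ cong suc (countLe-between lo hi i) ⟩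
  suc (i ⊓ suc l)          ≡⟨ cong suc (m≤n⇒m⊓n≡m (m≤n⇒m≤1+n i≤l)) ⟩
  suc i                    ≡⟨ cong suc (sym (m≤n⇒m⊓n≡m i≤l)) ⟩
  suc (i ⊓ l)              ∎
  where open ≡-Reasoning
... | no i≰l = begin
  countLe (suc i) n        ≡⟨ countLe-0 i (<-≤-trans hi (F-mono-≤ l<i)) ⟩
  countLe i n              ≡⟨ countLe-between lo hi i ⟩
  i ⊓ suc l                ≡⟨ m≥n⇒m⊓n≡n l<i ⟩
  suc l                    ≡⟨ cong suc (sym (m≥n⇒m⊓n≡n (<⇒≤ l<i))) ⟩
  suc (i ⊓ l)              ∎
  where
  open ≡-Reasoning
  l<i = ≰⇒> i≰l

countLe-normal : ∀ {w} → Zeckendorf (1 ∷ w) →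
                 countLe (value 0 (1 ∷ w)) (value 0 (1 ∷ w)) ≡ suc (length w)
countLe-normal {w} z =
  trans (countLe-between lead (value-< 0 z) n) (m≥n⇒m⊓n≡n (<-≤-trans (n<F[n] (length w)) lead))
  where
  n = value 0 (1 ∷ w)
  lead = F≤value-1∷ 0 w

repF-value : ∀ {w} → Normal w → repF (value 0 w) ≡ w
repF-value [] = refl
repF-value {1 ∷ w} (1∷ z) =
  trans (cong (λ i → greedy i (value 0 (1 ∷ w))) (countLe-normal z)) (greedy-value z)

strip-leading-zeros : ∀ {w} → Zeckendorf w → ∃[ u ] Normal u × value 0 u ≡ value 0 w
strip-leading-zeros [] = [] , [] , refl
strip-leading-zeros (0∷ z) = strip-leading-zeros z
strip-leading-zeros z@1∷[] = _ , 1∷ z , refl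
strip-leading-zeros z@(10∷ _) = _ , 1∷ z , refl

normal-representation : ∀ n → ∃[ w ] Normal w × value 0 w ≡ n
normal-representation n with z , eq ← greedy-correct (suc n) (<-trans (n<F[n] n) (F[n]<F[1+n] n))
                        with w , nw , eq′ ← strip-leading-zeros z = w , nw , trans eq′ eq

repF-correct : ∀ n → Normal (repF n) × value 0 (repF n) ≡ n
repF-correct n with w , nw , refl ← normal-representation n rewrite repF-value nw = nw , refl

repF-normal : ∀ n → Normal (repF n)
repF-normal n = proj₁ (repF-correct n)

value-repF : ∀ n → value 0 (repF n) ≡ n
value-repF n = proj₂ (repF-correct n)

repF-injective : ∀ {m n} → repF m ≡ repF n → m ≡ n
repF-injective {m} {n} eq = trans (sym (value-repF m)) (trans (cong (value 0) eq) (value-repF n))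

-- The pairs (shift m , shift m + m + 1)

value-<-sameLength : ∀ k j {u v} → Zeckendorf u → Zeckendorf v → length u ≡ length v →
                     value k u < value k v → value j u < value j v
value-<-sameLength k j {0 ∷ u} {0 ∷ v} zu zv eq lt =
  value-<-sameLength k j (Zeckendorf-tail zu) (Zeckendorf-tail zv) (suc-injective eq) lt
value-<-sameLength k j {0 ∷ u} {1 ∷ v} zu zv eq lt = begin-strict
  value j u                <⟨ value-< j (Zeckendorf-tail zu) ⟩
  F (j + length u)         ≡⟨ cong (λ l → F (j + l)) (suc-injective eq) ⟩
  F (j + length v)         ≤⟨ F≤value-1∷ j v ⟩
  value j (1 ∷ v)          ∎
  where open ≤-Reasoning
value-<-sameLength k j {1 ∷ u} {0 ∷ v} zu zv eq lt = contradiction lt (≤⇒≯ (begin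
  value k v                <⟨ value-< k (Zeckendorf-tail zv) ⟩
  F (k + length v)         ≡⟨ cong (λ l → F (k + l)) (suc-injective (sym eq)) ⟩
  F (k + length u)         ≤⟨ F≤value-1∷ k u ⟩
  value k (1 ∷ u)          ∎))
  where open ≤-Reasoning
value-<-sameLength k j {1 ∷ u} {1 ∷ v} zu zv eq lt = begin-strict
  value j (1 ∷ u)                ≡⟨ value-1∷ j u ⟩
  F (j + length u) + value j u   <⟨ +-monoʳ-< _ (value-<-sameLength k j zu′ zv′ eq′ tails<) ⟩
  F (j + length u) + value j v   ≡⟨ cong (λ l → F (j + l) + value j v) eq′ ⟩
  F (j + length v) + value j v   ≡⟨ sym (value-1∷ j v) ⟩
  value j (1 ∷ v)                ∎
  where
  open ≤-Reasoning
  zu′ = Zeckendorf-tail zu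
  zv′ = Zeckendorf-tail zv
  eq′ = suc-injective eq
  tails< : value k u < value k v
  tails< = +-cancelˡ-< (F (k + length u)) _ _ (begin-strict
    F (k + length u) + value k u   ≡⟨ sym (value-1∷ k u) ⟩
    value k (1 ∷ u)                <⟨ lt ⟩
    value k (1 ∷ v)                ≡⟨ value-1∷ k v ⟩
    F (k + length v) + value k v   ≡⟨ cong (λ l → F (k + l) + value k v) (sym eq′) ⟩
    F (k + length u) + value k v   ∎)

pad : ℕ → List ℕ → List ℕ
pad n u = replicate (n ∸ length u) 0 ++ u

value-pad : ∀ k n u → value k (pad n u) ≡ value k u
value-pad k n u = go (n ∸ length u)
  where
  go : ∀ i → value k (replicate i 0 ++ u) ≡ value k u
  go zero = refl
  go (suc i) = go i

Zeckendorf-pad : ∀ n {u} → Zeckendorf u → Zeckendorf (pad n u)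
Zeckendorf-pad n {u} z = go (n ∸ length u)
  where
  go : ∀ i → Zeckendorf (replicate i 0 ++ u)
  go zero = z
  go (suc i) = 0∷ go i

length-pad : ∀ {n} u → length u ≤ n → length (pad n u) ≡ n
length-pad {n} u u≤n = begin
  length (replicate (n ∸ length u) 0 ++ u)      ≡⟨ length-++ (replicate (n ∸ length u) 0) ⟩
  length (replicate (n ∸ length u) 0) + length u ≡⟨ cong (_+ length u) (length-replicate (n ∸ length u)) ⟩
  n ∸ length u + length u                        ≡⟨ m∸n+n≡m u≤n ⟩
  n                                              ∎
  where open ≡-Reasoning

value-<-reweight : ∀ k j {u v} → Zeckendorf u → Zeckendorf v → value k u < value k v → value j u < value j v
value-<-reweight k j {u} {v} zu zv lt =
  subst₂ _<_ (value-pad j n u) (value-pad j n v)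
    (value-<-sameLength k j (Zeckendorf-pad n zu) (Zeckendorf-pad n zv)
      (trans (length-pad u (m≤m⊔n _ _)) (sym (length-pad v (m≤n⊔m _ _))))
      (subst₂ _<_ (sym (value-pad k n u)) (sym (value-pad k n v)) lt))
  where n = length u ⊔ length v

repF≡⇒≡value : ∀ n {w} → repF n ≡ w → n ≡ value 0 w
repF≡⇒≡value n eq = trans (sym (value-repF n)) (cong (value 0) eq)

repF-prefix : ∀ n u {v} → repF n ≡ u ++ v → repF (value 0 u) ≡ u
repF-prefix n u eq = repF-value (Normal-++⁻ˡ u (subst Normal eq (repF-normal n)))

value-∷ʳ0 : ∀ w → value 0 (w ∷ʳ 0) ≡ value 1 w
value-∷ʳ0 w = trans (value-∷ʳ 0 w 0) (+-identityʳ _)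

value-∷ʳ0∷ʳ1 : ∀ w → value 0 (w ∷ʳ 0 ∷ʳ 1) ≡ value 1 w + suc (value 0 w)
value-∷ʳ0∷ʳ1 w = begin
  value 0 (w ∷ʳ 0 ∷ʳ 1)          ≡⟨ value-∷ʳ 0 (w ∷ʳ 0) 1 ⟩
  value 1 (w ∷ʳ 0) + 1           ≡⟨ cong (_+ 1) (trans (value-∷ʳ 1 w 0) (+-identityʳ _)) ⟩
  value 2 w + 1                  ≡⟨ cong (_+ 1) (value-fib 0 w) ⟩
  value 1 w + value 0 w + 1      ≡⟨ +-assoc (value 1 w) _ 1 ⟩
  value 1 w + (value 0 w + 1)    ≡⟨ cong (value 1 w +_) (+-comm _ 1) ⟩
  value 1 w + suc (value 0 w)    ∎
  where open ≡-Reasoning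

shift : ℕ → ℕ
shift m = value 1 (repF m)

shift-<-mono : ∀ {m n} → m < n → shift m < shift n
shift-<-mono {m} {n} m<n =
  value-<-reweight 0 1 (Normal⇒Zeckendorf (repF-normal m)) (Normal⇒Zeckendorf (repF-normal n))
    (subst₂ _<_ (sym (value-repF m)) (sym (value-repF n)) m<n)

2≤shift : ∀ {m} → 1 ≤ m → 2 ≤ shift m
2≤shift 1≤m with m≤n⇒m<n∨m≡n 1≤m
... | inj₁ 1<m = <⇒≤ (shift-<-mono 1<m)
... | inj₂ refl = ≤-refl

repF-extend : ∀ {m v} → 1 ≤ m → Zeckendorf (0 ∷ v) →
              repF (value 0 (repF m ++ 0 ∷ v)) ≡ repF m ++ 0 ∷ v
repF-extend {m} 1≤m z = repF-value (Normal-++ (repF-normal m) (subst (0 <_) (sym (value-repF m)) 1≤m) z)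

repF-shift : ∀ {m} → 1 ≤ m → repF (shift m) ≡ repF m ∷ʳ 0
repF-shift {m} 1≤m = trans (cong repF (sym (value-∷ʳ0 (repF m)))) (repF-extend 1≤m (0∷ []))

repF-shift+suc : ∀ {m} → 1 ≤ m → repF (shift m + suc m) ≡ repF m ∷ʳ 0 ∷ʳ 1
repF-shift+suc {m} 1≤m = begin
  repF (shift m + suc m)
    ≡⟨ cong repF (sym (trans (value-∷ʳ0∷ʳ1 w) (cong (λ k → shift m + suc k) (value-repF m)))) ⟩
  repF (value 0 (w ∷ʳ 0 ∷ʳ 1))            ≡⟨ cong (repF ∘ value 0) (++-assoc w [ 0 ] [ 1 ]) ⟩
  repF (value 0 (w ++ 0 ∷ 1 ∷ []))        ≡⟨ repF-extend 1≤m (0∷ 1∷[]) ⟩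
  w ++ 0 ∷ 1 ∷ []                         ≡⟨ sym (++-assoc w [ 0 ] [ 1 ]) ⟩
  w ∷ʳ 0 ∷ʳ 1                             ∎
  where
  open ≡-Reasoning
  w = repF m

record FibPair (a b : ℕ) : Set where
  constructor fibPair
  field
    first-positive    : 1 ≤ a
    first-ends-with-0 : ∃[ w ] repF a ≡ w ∷ʳ 0
    second≡first∷ʳ1   : repF b ≡ repF a ∷ʳ 1

FibPair-shift : ∀ {m} → 1 ≤ m → FibPair (shift m) (shift m + suc m)
FibPair-shift {m} 1≤m = fibPair
  (≤-trans (s≤s z≤n) (2≤shift 1≤m)) (repF m , repF-shift 1≤m)
  (trans (repF-shift+suc 1≤m) (cong (_∷ʳ 1) (sym (repF-shift 1≤m))))

repF-∷ʳ0⇒≡shift : ∀ a u → repF a ≡ u ∷ʳ 0 → a ≡ shift (value 0 u)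
repF-∷ʳ0⇒≡shift a u eq =
  trans (repF≡⇒≡value a eq) (trans (value-∷ʳ0 u) (cong (value 1) (sym (repF-prefix a u eq))))

repF-∷ʳ01⇒≡shift+suc : ∀ b u → repF b ≡ u ∷ʳ 0 ∷ʳ 1 → b ≡ shift (value 0 u) + suc (value 0 u)
repF-∷ʳ01⇒≡shift+suc b u eq = trans (repF≡⇒≡value b eq) (trans (value-∷ʳ0∷ʳ1 u)
  (cong (λ w → value 1 w + suc (value 0 u)) (sym (repF-prefix b u (trans eq (++-assoc u [ 0 ] [ 1 ]))))))

shift-positive⁻¹ : ∀ {m} → 1 ≤ shift m → 1 ≤ m
shift-positive⁻¹ {zero} ()
shift-positive⁻¹ {suc _} _ = s≤s z≤n

FibPair-index : ∀ {a b} → FibPair a b → ∃[ m ] 1 ≤ m × a ≡ shift m × b ≡ shift m + suc m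
FibPair-index {a} {b} (fibPair 1≤a (u , ra) rb) =
  value 0 u , shift-positive⁻¹ (subst (1 ≤_) a≡ 1≤a) , a≡ ,
  repF-∷ʳ01⇒≡shift+suc b u (trans rb (cong (_∷ʳ 1) ra))
  where a≡ = repF-∷ʳ0⇒≡shift a u ra

data Ending : List ℕ → Set where
  empty   : Ending []
  one     : Ending [ 1 ]
  ends-0  : ∀ u → Ending (u ∷ʳ 0)
  ends-01 : ∀ u → Ending (u ∷ʳ 0 ∷ʳ 1)

ending : ∀ {w} → Zeckendorf w → Ending w
ending [] = empty
ending (0∷ z) with ending z
... | empty = ends-0 []
... | one = ends-01 []
... | ends-0 u = ends-0 (0 ∷ u)
... | ends-01 u = ends-01 (0 ∷ u)
ending 1∷[] = one
ending (10∷ z) with ending z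
... | empty = ends-0 [ 1 ]
... | one = ends-01 [ 1 ]
... | ends-0 u = ends-0 (1 ∷ 0 ∷ u)
... | ends-01 u = ends-01 (1 ∷ 0 ∷ u)

shift+suc-positive⁻¹ : ∀ {m} → 2 ≤ shift m + suc m → 1 ≤ m
shift+suc-positive⁻¹ {zero} (s≤s ())
shift+suc-positive⁻¹ {suc _} _ = s≤s z≤n

FibPair-cover : ∀ {n} → 2 ≤ n → (∃[ b ] FibPair n b) ⊎ (∃[ a ] FibPair a n)
FibPair-cover {n} 2≤n = by-ending (ending (Normal⇒Zeckendorf (repF-normal n))) refl
  where
  by-ending : ∀ {w} → Ending w → repF n ≡ w → (∃[ b ] FibPair n b) ⊎ (∃[ a ] FibPair a n)
  by-ending empty eq = contradiction (subst (2 ≤_) (repF≡⇒≡value n eq) 2≤n) λ ()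
  by-ending one eq = contradiction (subst (2 ≤_) (repF≡⇒≡value n eq) 2≤n) λ { (s≤s ()) }
  by-ending (ends-0 u) eq =
    inj₁ (shift m + suc m , subst (λ a → FibPair a (shift m + suc m)) (sym n≡) (FibPair-shift 1≤m))
    where
    m = value 0 u
    n≡ = repF-∷ʳ0⇒≡shift n u eq
    1≤m = shift-positive⁻¹ (subst (1 ≤_) n≡ (<⇒≤ 2≤n))
  by-ending (ends-01 u) eq = inj₂ (shift m , subst (FibPair (shift m)) (sym n≡) (FibPair-shift 1≤m))
    where
    m = value 0 u
    n≡ = repF-∷ʳ01⇒≡shift+suc n u eq
    1≤m = shift+suc-positive⁻¹ (subst (2 ≤_) n≡ 2≤n)

FibPair-2≤ : ∀ {a b} → FibPair a b → 2 ≤ a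
FibPair-2≤ p with _ , 1≤m , refl , refl ← FibPair-index p = 2≤shift 1≤m

FibPair-gap : ∀ {a b} → FibPair a b → 2 ≤ b ∸ a
FibPair-gap p with m , 1≤m , refl , refl ← FibPair-index p =
  subst (2 ≤_) (sym (m+n∸m≡n (shift m) (suc m))) (s≤s 1≤m)

2≤n∸m⇒m<n : ∀ {m n} → 2 ≤ n ∸ m → m < n
2≤n∸m⇒m<n 2≤n∸m = m∸n≢0⇒n<m (λ eq → contradiction (subst (2 ≤_) eq 2≤n∸m) λ ())

FibPair-< : ∀ {a b} → FibPair a b → a < b
FibPair-< p = 2≤n∸m⇒m<n (FibPair-gap p)

FibPair-injectiveˡ : ∀ {a a′ b} → FibPair a b → FibPair a′ b → a ≡ a′
FibPair-injectiveˡ {a} {a′} (fibPair _ _ rb) (fibPair _ _ rb′) =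
  repF-injective (∷ʳ-injectiveˡ (repF a) (repF a′) (trans (sym rb) rb′))

FibPair-injectiveʳ : ∀ {a b b′} → FibPair a b → FibPair a b′ → b ≡ b′
FibPair-injectiveʳ (fibPair _ _ rb) (fibPair _ _ rb′) = repF-injective (trans rb (sym rb′))

FibPair-∸-injective : ∀ {a b a′ b′} → FibPair a b → FibPair a′ b′ → b ∸ a ≡ b′ ∸ a′ → a ≡ a′
FibPair-∸-injective p q eq
  with m , _ , refl , refl ← FibPair-index p | m′ , _ , refl , refl ← FibPair-index q =
  cong shift (suc-injective (begin
    suc m                              ≡⟨ sym (m+n∸m≡n (shift m) (suc m)) ⟩
    shift m + suc m ∸ shift m          ≡⟨ eq ⟩
    shift m′ + suc m′ ∸ shift m′       ≡⟨ m+n∸m≡n (shift m′) (suc m′) ⟩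
    suc m′                             ∎))
  where open ≡-Reasoning

FibPair-first≢second : ∀ {a b c} → FibPair a b → ¬ FibPair c a
FibPair-first≢second {c = c} (fibPair _ (u , ra) _) (fibPair _ _ ra′) =
  contradiction (∷ʳ-injectiveʳ u (repF c) (trans (sym ra) ra′)) λ ()

-- Kernels of the move graph

data Move′ : ℕ → ℕ → ℕ → ℕ → Set where
  left  : ∀ {x x′ y} → x′ < x → Move′ x y x′ y
  right : ∀ {x y y′} → y′ < y → Move′ x y x y′
  diag  : ∀ {x y x′ y′} i → 1 ≤ i → i + x′ ≡ x → i + y′ ≡ y → Move′ x y x′ y′

Move⇒Move′ : ∀ {x y x′ y′} → Move x y x′ y′ → Move′ x y x′ y′
Move⇒Move′ (left i 1≤i i≤x) = left (∸-monoʳ-< 1≤i i≤x)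
Move⇒Move′ (right i 1≤i i≤y) = right (∸-monoʳ-< 1≤i i≤y)
Move⇒Move′ (diag i 1≤i i≤x i≤y) = diag i 1≤i (m+[n∸m]≡n i≤x) (m+[n∸m]≡n i≤y)

Move′⇒Move : ∀ {x y x′ y′} → Move′ x y x′ y′ → Move x y x′ y′
Move′⇒Move {x} {y} (left {x′ = x′} x′<x) =
  subst (λ a → Move x y a y) (m∸[m∸n]≡n (<⇒≤ x′<x))
    (left (x ∸ x′) (m<n⇒0<n∸m x′<x) (m∸n≤m x x′))
Move′⇒Move {x} {y} (right {y′ = y′} y′<y) =
  subst (λ b → Move x y x b) (m∸[m∸n]≡n (<⇒≤ y′<y))
    (right (y ∸ y′) (m<n⇒0<n∸m y′<y) (m∸n≤m y y′))
Move′⇒Move {x′ = x′} {y′} (diag i 1≤i refl refl) =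
  subst₂ (Move (i + x′) (i + y′)) (m+n∸m≡n i x′) (m+n∸m≡n i y′)
    (diag i 1≤i (m≤m+n i x′) (m≤m+n i y′))

Move-swap : ∀ {x y x′ y′} → Move x y x′ y′ → Move y x y′ x′
Move-swap (left i 1≤i i≤x) = right i 1≤i i≤x
Move-swap (right i 1≤i i≤y) = left i 1≤i i≤y
Move-swap (diag i 1≤i i≤x i≤y) = diag i 1≤i i≤y i≤x

Move-decreasing : ∀ {x y x′ y′} → Move x y x′ y′ → x′ + y′ < x + y
Move-decreasing mv with Move⇒Move′ mv
... | left {y = y} x′<x = +-monoˡ-< y x′<x
... | right {x = x} y′<y = +-monoʳ-< x y′<y
... | diag {x′ = x′} {y′} i 1≤i refl refl = +-mono-< (m<n+m x′ 1≤i) (m<n+m y′ 1≤i)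

module _ (ℓ : ℕ) (K : ℕ → ℕ → Set)
         (terminal⇒K : ∀ {x y} → x + y ≤ ℓ → K x y)
         (K-independent : ∀ {x y x′ y′} → ℓ < x + y → K x y → Move x y x′ y′ → ¬ K x′ y′)
         (K-absorbing : ∀ x y → K x y ⊎ ∃₂ λ x′ y′ → Move x y x′ y′ × K x′ y′)
  where

  private
    record Classified (x y : ℕ) : Set where
      field
        P⇒K  : IsP ℓ x y → K x y
        K⇒P  : K x y → IsP ℓ x y
        N⇒¬K : IsN ℓ x y → ¬ K x y
        ¬K⇒N : ¬ K x y → IsN ℓ x y

    classified-step : ∀ {x y} → (∀ {x′ y′} → Move x y x′ y′ → Classified x′ y′) →
                      Classified x y
    classified-step {x} {y} ih = record { P⇒K = P⇒K ; K⇒P = K⇒P ; N⇒¬K = N⇒¬K ; ¬K⇒N = ¬K⇒N }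
      where
      P⇒K : IsP ℓ x y → K x y
      P⇒K (terminal t) = terminal⇒K t
      P⇒K (allN _ toN) with K-absorbing x y
      ... | inj₁ k = k
      ... | inj₂ (x′ , y′ , mv , k′) = contradiction k′ (Classified.N⇒¬K (ih mv) (toN x′ y′ mv))
      K⇒P : K x y → IsP ℓ x y
      K⇒P k with x + y ≤? ℓ
      ... | yes t = terminal t
      ... | no t̸ = allN (≰⇒> t̸) λ x′ y′ mv →
        Classified.¬K⇒N (ih mv) (K-independent (≰⇒> t̸) k mv)
      N⇒¬K : IsN ℓ x y → ¬ K x y
      N⇒¬K (someP ℓ<x+y x′ y′ mv p) k = K-independent ℓ<x+y k mv (Classified.P⇒K (ih mv) p)
      ¬K⇒N : ¬ K x y → IsN ℓ x y
      ¬K⇒N ¬k with K-absorbing x y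
      ... | inj₁ k = contradiction k ¬k
      ... | inj₂ (x′ , y′ , mv , k′) =
        someP (≰⇒> (¬k ∘ terminal⇒K)) x′ y′ mv (Classified.K⇒P (ih mv) k′)

    classified : ∀ n {x y} → x + y < n → Classified x y
    classified zero ()
    classified (suc n) x+y<n =
      classified-step λ mv → classified n (<-≤-trans (Move-decreasing mv) (≤-pred x+y<n))

  IsP⇔kernel : ∀ x y → IsP ℓ x y ⇔ K x y
  IsP⇔kernel x y = mk⇔ P⇒K K⇒P
    where open Classified (classified (suc (x + y)) {x} {y} ≤-refl)

-- The kernel of K¹

Kernel : ℕ → ℕ → Set
Kernel x y = x + y ≤ 1 ⊎ FibPair x y ⊎ FibPair y x

Kernel-sym : ∀ {x y} → Kernel x y → Kernel y x
Kernel-sym {x} {y} (inj₁ t) = inj₁ (subst (_≤ 1) (+-comm x y) t)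
Kernel-sym (inj₂ (inj₁ p)) = inj₂ (inj₂ p)
Kernel-sym (inj₂ (inj₂ p)) = inj₂ (inj₁ p)

FibPair-independent : ∀ {x y x′ y′} → FibPair x y → Move′ x y x′ y′ → ¬ Kernel x′ y′
FibPair-independent {x} {y} p (left {x′ = x′} _) (inj₁ t) =
  <⇒≱ (≤-trans (≤-trans (FibPair-gap p) (m∸n≤m y x)) (m≤n+m y x′)) t
FibPair-independent p (left x′<x) (inj₂ (inj₁ q)) = <⇒≢ x′<x (FibPair-injectiveˡ q p)
FibPair-independent p (left _) (inj₂ (inj₂ q)) = FibPair-first≢second q p
FibPair-independent {x} {y} p (right {y′ = y′} _) (inj₁ t) =
  <⇒≱ (≤-trans (FibPair-2≤ p) (m≤m+n x y′)) t
FibPair-independent p (right y′<y) (inj₂ (inj₁ q)) = <⇒≢ y′<y (FibPair-injectiveʳ q p)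
FibPair-independent p (right _) (inj₂ (inj₂ q)) = FibPair-first≢second p q
FibPair-independent {x′ = x′} {y′} p (diag i 1≤i refl refl) = λ
  { (inj₁ t) → <⇒≱ (≤-trans (≤-trans gap (m∸n≤m y′ x′)) (m≤n+m y′ x′)) t
  ; (inj₂ (inj₁ q)) → <⇒≢ (m<n+m x′ 1≤i) (FibPair-∸-injective q p (sym same-difference))
  ; (inj₂ (inj₂ q)) → <-asym (FibPair-< q) (2≤n∸m⇒m<n gap) }
  where
  same-difference : (i + y′) ∸ (i + x′) ≡ y′ ∸ x′
  same-difference = [m+n]∸[m+o]≡n∸o i y′ x′
  gap : 2 ≤ y′ ∸ x′
  gap = subst (2 ≤_) same-difference (FibPair-gap p)

Kernel-independent : ∀ {x y x′ y′} → 1 < x + y → Kernel x y → Move x y x′ y′ → ¬ Kernel x′ y′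
Kernel-independent 1<x+y (inj₁ t) _ = contradiction t (<⇒≱ 1<x+y)
Kernel-independent _ (inj₂ (inj₁ p)) mv = FibPair-independent p (Move⇒Move′ mv)
Kernel-independent _ (inj₂ (inj₂ p)) mv = FibPair-independent p (Move⇒Move′ (Move-swap mv)) ∘ Kernel-sym

ReachesKernel : ℕ → ℕ → Set
ReachesKernel x y = ∃₂ λ x′ y′ → Move′ x y x′ y′ × Kernel x′ y′

reaches-Kernel-below-FibPair : ∀ {x y b} → FibPair x b → x ≤ y → y < b → ReachesKernel x y
reaches-Kernel-below-FibPair {x} {y} p x≤y y<b with m , 1≤m , refl , refl ← FibPair-index p =
  by-difference (y ∸ shift m) (m+[n∸m]≡n x≤y)
  where
  1≤shift = ≤-trans (s≤s z≤n) (2≤shift 1≤m)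
  by-difference : ∀ d → shift m + d ≡ y → ReachesKernel (shift m) y
  by-difference 0 eq = 0 , 0 , diag (shift m) 1≤shift (+-identityʳ _) eq , inj₁ z≤n
  by-difference 1 eq = 0 , 1 , diag (shift m) 1≤shift (+-identityʳ _) eq , inj₁ ≤-refl
  by-difference d@(suc (suc j)) eq =
    shift k , shift k + d , diag i (m<n⇒0<n∸m shift-k<shift-m) i+shift-k≡ i+pair≡ ,
    inj₂ (inj₁ (FibPair-shift (s≤s z≤n)))
    where
    k = suc j
    k<m : k < m
    k<m = ≤-pred (+-cancelˡ-< (shift m) _ _ (subst (_< shift m + suc m) (sym eq) y<b))
    shift-k<shift-m = shift-<-mono k<m
    i = shift m ∸ shift k
    i+shift-k≡ : i + shift k ≡ shift m
    i+shift-k≡ = m∸n+n≡m (<⇒≤ shift-k<shift-m)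
    i+pair≡ : i + (shift k + d) ≡ y
    i+pair≡ = trans (sym (+-assoc i (shift k) d)) (trans (cong (_+ d) i+shift-k≡) eq)

Kernel-absorbing-≤1 : ∀ {x} → x ≤ 1 → ∀ y → Kernel x y ⊎ ReachesKernel x y
Kernel-absorbing-≤1 {x} x≤1 = λ
  { zero    → inj₁ (inj₁ x+0≤1)
  ; (suc _) → inj₂ (x , 0 , right (s≤s z≤n) , inj₁ x+0≤1) }
  where x+0≤1 = subst (_≤ 1) (sym (+-identityʳ x)) x≤1

Kernel-absorbing-≤ : ∀ {x y} → x ≤ y → Kernel x y ⊎ ReachesKernel x y
Kernel-absorbing-≤ {x} {y} x≤y with x ≤? 1
... | yes x≤1 = Kernel-absorbing-≤1 x≤1 y
... | no x≰1 with FibPair-cover (≰⇒> x≰1)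
...   | inj₂ (a , p) = inj₂ (x , a , right (<-≤-trans (FibPair-< p) x≤y) , inj₂ (inj₂ p))
...   | inj₁ (b , p) with <-cmp y b
...     | tri< y<b _ _ = inj₂ (reaches-Kernel-below-FibPair p x≤y y<b)
...     | tri≈ _ refl _ = inj₁ (inj₂ (inj₁ p))
...     | tri> _ _ b<y = inj₂ (x , b , right b<y , inj₂ (inj₁ p))

Kernel-absorbing : ∀ x y → Kernel x y ⊎ ∃₂ λ x′ y′ → Move x y x′ y′ × Kernel x′ y′
Kernel-absorbing x y with ≤-total x y
... | inj₁ x≤y =
  Sum.map₂ (λ (x′ , y′ , mv , k) → x′ , y′ , Move′⇒Move mv , k) (Kernel-absorbing-≤ x≤y)
... | inj₂ y≤x =
  Sum.map Kernel-sym (λ (y′ , x′ , mv , k) → x′ , y′ , Move-swap (Move′⇒Move mv) , Kernel-sym k)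
    (Kernel-absorbing-≤ y≤x)

terminal-≤ : ∀ {a b} → a ≤ b → a + b ≤ 1 → (a ≡ 0 × b ≡ 0) ⊎ (a ≡ 0 × b ≡ 1)
terminal-≤ {zero} {zero} _ _ = inj₁ (refl , refl)
terminal-≤ {zero} {suc zero} _ _ = inj₂ (refl , refl)
terminal-≤ {zero} {suc (suc _)} _ (s≤s ())
terminal-≤ {suc a} {suc b} _ (s≤s t) = contradiction (≤-trans (m≤n+m (suc b) a) t) λ ()

Kernel⇔small-or-FibPair : ∀ {a b} → a ≤ b →
  Kernel a b ⇔ ((a ≡ 0 × b ≡ 0) ⊎ (a ≡ 0 × b ≡ 1) ⊎
                (1 ≤ a × (∃[ w ] repF a ≡ w ++ [ 0 ]) × repF b ≡ repF a ++ [ 1 ]))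
Kernel⇔small-or-FibPair a≤b = mk⇔
  (λ { (inj₁ t) → Sum.map₂ inj₁ (terminal-≤ a≤b t)
     ; (inj₂ (inj₁ (fibPair 1≤a e r))) → inj₂ (inj₂ (1≤a , e , r))
     ; (inj₂ (inj₂ p)) → contradiction a≤b (<⇒≱ (FibPair-< p)) })
  (λ { (inj₁ (refl , refl)) → inj₁ z≤n
     ; (inj₂ (inj₁ (refl , refl))) → inj₁ ≤-refl
     ; (inj₂ (inj₂ (1≤a , e , r))) → inj₂ (inj₁ (fibPair 1≤a e r)) })

theorem12 : ∀ (a b : ℕ) → a ≤ b →
    IsP 1 a b ⇔
    ((a ≡ 0 × b ≡ 0) ⊎ (a ≡ 0 × b ≡ 1) ⊎
    (1 ≤ a × (∃[ w ] repF a ≡ w ++ [ 0 ]) × repF b ≡ repF a ++ [ 1 ]))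
theorem12 a b a≤b =
  ⇔-trans (IsP⇔kernel 1 Kernel inj₁ Kernel-independent Kernel-absorbing a b) (Kernel⇔small-or-FibPair a≤b)
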